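{- Let $n\ge 1$ and let $T$ be a plane tree with $n$ edges (as a set of index pairs). Then $\rho(\phi(T)) = \kappa(\rho(T))$, where $\phi$, $\rho$, $\kappa$ are as defined in the context.
   Context: Plane trees and indices: a plane tree is a rooted tree whose children at each vertex are linearly ordered. For a plane tree with $n$ edges, walk around its boundary counterclockwise from the root and label the $2n$ successive edge-sides $1,\dots,2n$; each edge gets labels $i<j$ and is written $(i,j)$. Thus $T$ is identified with a noncrossing perfect matching of $[1,2n]$. The map $\phi$: $\phi(T) = \{(k-1,2n) \mid (1,k) \in T\} \cup \{(i-1,j-1) \mid (i,j) \in T,\ 1 < i\}$ (rerooting one step counterclockwise). Parity: exactly one index of each edge is odd. An edge $(i,j)$ is called odd if $i$ is odd and even otherwise. The root is an even vertex; every other vertex has the parity of the edge joining it to its parent. (Edges at the root are odd, and parities alternate along root-to-leaf paths, so all child edges of an even vertex are odd.) The map $\rho$ from plane trees with $n$ edges to noncrossing partitions of $[1,n]$: for each even vertex $v$, let $S_v$ be the set of edges consisting of all edges from $v$ to its (odd) children together with the edge from $v$ to its parent if $v$ is not the root. The sets $S_v$ partition the edge set. The block of $\rho(T)$ associated with $v$ is $\{(m+1)/2 : m \text{ is the odd index of some edge in } S_v\}$ (projecting $2i-1\mapsto i$). Then $\rho(T)$ is the partition of $[1,n]$ into these blocks. Noncrossing partitions: a set partition $\mathcal P$ of $[1,n]$ is noncrossing if there are no $a,c$ in one block and $b,d$ in a different block with $a<b<c<d$. Kreweras complement $\kappa$: interleave a second copy $N'=\{1',\dots,n'\}$ of $[1,n]$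 as $1<1'<2<2'<\dots<n<n'$; for a noncrossing partition $\mathcal P$ of $[1,n]$, $\kappa(\mathcal P)$ is the coarsest noncrossing partition $\mathcal P'$ of $N'$ (identified with $[1,n]$ via $i'\mapsto i$) such that $\mathcal P\cup\mathcal P'$ is a noncrossing partition of the totally ordered set $[1,n]\cup N'$. -}

module Defs where

open import Data.Nat using (ℕ; zero; suc; _+_; _*_; _∸_; _≤_; _<_; _≡ᵇ_; _%_; _/_)
open import Data.Bool using (Bool; true; false; if_then_else_)
open import Data.Fin using (Fin; toℕ)
open import Data.Product using (_×_; _,_; proj₁; proj₂; Σ; ∃; ∃-syntax)
open import Data.Sum using (_⊎_; inj₁; inj₂)
open import Data.Empty using (⊥)
open import Data.Unit using (⊤)
open import Data.List using (List; map)
open import Data.List.Membership.Propositional using (_∈_)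
open import Relation.Nullary using (¬_)
open import Relation.Binary.PropositionalEquality using (_≡_)
open import Relation.Binary.Structures using (IsEquivalence)

-- An edge (i , j) with i < j, indices in [1,2n].
Edge : Set
Edge = ℕ × ℕ

-- A set of index pairs (a list, read as a set via membership).
PairSet : Set
PairSet = List Edge

-- The plane tree with n edges, identified with a noncrossing perfect
-- matching of [1,2n].
record IsPlaneTree (n : ℕ) (T : PairSet) : Set where
  field
    ordered    : ∀ {i j} → (i , j) ∈ T → 1 ≤ i × i < j × j ≤ 2 * n
    covers     : ∀ m → 1 ≤ m → m ≤ 2 * n →
                 ∃[ e ] (e ∈ T × (proj₁ e ≡ m ⊎ proj₂ e ≡ m))
    disjoint   : ∀ {e f} → e ∈ T → f ∈ T →
                 (proj₁ e ≡ proj₁ f ⊎ proj₁ e ≡ proj₂ f ⊎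
                  proj₂ e ≡ proj₁ f ⊎ proj₂ e ≡ proj₂ f) → e ≡ f
    noncrossing : ∀ {i j k l} → (i , j) ∈ T → (k , l) ∈ T →
                  i < k → k < j → j < l → ⊥

φ-edge : ℕ → Edge → Edge
φ-edge n (i , j) = if i ≡ᵇ 1 then (j ∸ 1 , 2 * n) else (i ∸ 1 , j ∸ 1)

φ : ℕ → PairSet → PairSet
φ n T = map (φ-edge n) T

-- Edge e lies strictly inside edge f (e is in the subtree below f).
_⊏_ : Edge → Edge → Set
(i , j) ⊏ (k , l) = k < i × j < l

-- f is the edge immediately above e, i.e. e joins the child endpoint
-- of f (the vertex below f) to one of its children.
ParentEdge : PairSet → Edge → Edge → Set
ParentEdge T e f = f ∈ T × e ⊏ f × (∀ g → g ∈ T → e ⊏ g → g ⊏ f → ⊥)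

-- e is an edge at the root (not nested in any edge).
TopEdge : PairSet → Edge → Set
TopEdge T e = ∀ g → g ∈ T → e ⊏ g → ⊥

-- Vertices: the root, or the child endpoint of an edge of T.
data Vertex (T : PairSet) : Set where
  root  : Vertex T
  below : (e : Edge) → e ∈ T → Vertex T

IsOdd : ℕ → Set
IsOdd m = m % 2 ≡ 1

IsEvenℕ : ℕ → Set
IsEvenℕ m = m % 2 ≡ 0

OddEdge : Edge → Set
OddEdge (i , j) = IsOdd i

EvenEdge : Edge → Set
EvenEdge (i , j) = IsEvenℕ i

EvenVertex : {T : PairSet} → Vertex T → Set
EvenVertex root        = ⊤
EvenVertex (below e _) = EvenEdge e

-- S_v: child edges of v, together with the parent edge of v (if v ≠ root).
InS : (T : PairSet) → Vertex T → Edge → Set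
InS T root        g = g ∈ T × TopEdge T g
InS T (below e _) g = g ≡ e ⊎ (g ∈ T × ParentEdge T g e)

-- The odd index of an edge (exactly one of its indices is odd).
oddIndex : Edge → ℕ
oddIndex (i , j) = if i % 2 ≡ᵇ 1 then i else j

-- Element k of [1,n] (represented by k : Fin n, standing for toℕ k + 1)
-- lies in the block of ρ(T) associated with v.
InBlock : {n : ℕ} (T : PairSet) → Vertex T → Fin n → Set
InBlock T v k = ∃[ g ] (InS T v g × (oddIndex g + 1) / 2 ≡ suc (toℕ k))

-- ρ(T), as the "same block" relation on [1,n] (Fin n, shifted by one).
ρ : (n : ℕ) → PairSet → Fin n → Fin n → Set
ρ n T k l = ∃[ v ] (EvenVertex {T} v × InBlock T v k × InBlock T v l)

-- A set partition of a set A, given by its "same block" relation.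
Partition : Set → Set₁
Partition A = A → A → Set

NonCrossing : {A : Set} → (A → ℕ) → Partition A → Set
NonCrossing pos R = ∀ a b c d → pos a < pos b → pos b < pos c → pos c < pos d →
                    R a c → R b d → ¬ R a b → ⊥

posN : {n : ℕ} → Fin n → ℕ
posN k = toℕ k

IsNCPartition : (n : ℕ) → Partition (Fin n) → Set
IsNCPartition n R = IsEquivalence R × NonCrossing posN R

-- The interleaved totally ordered set [1,n] ∪ N' with
-- 1 < 1' < 2 < 2' < ... < n < n' : inj₁ k is k, inj₂ k is k'.
posInter : {n : ℕ} → Fin n ⊎ Fin n → ℕ
posInter (inj₁ k) = 2 * toℕ k
posInter (inj₂ k) = suc (2 * toℕ k)

-- P ∪ P' as a partition of [1,n] ∪ N' (P' lives on N' ≅ [1,n]).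
Union : {n : ℕ} → Partition (Fin n) → Partition (Fin n) →
        Partition (Fin n ⊎ Fin n)
Union P Q (inj₁ a) (inj₁ b) = P a b
Union P Q (inj₁ a) (inj₂ b) = ⊥
Union P Q (inj₂ a) (inj₁ b) = ⊥
Union P Q (inj₂ a) (inj₂ b) = Q a b

Refines : {A : Set} → Partition A → Partition A → Set
Refines Q' Q = ∀ a b → Q' a b → Q a b

IsKreweras : (n : ℕ) → Partition (Fin n) → Partition (Fin n) → Set₁
IsKreweras n P Q =
  IsNCPartition n Q × NonCrossing posInter (Union P Q) ×
  ((Q' : Partition (Fin n)) → IsNCPartition n Q' →
     NonCrossing posInter (Union P Q') → Refines Q' Q)

-- Number the gaps between consecutive edge-sides 0, 1, …, 2n − 1.  Every gap is a corner of a
-- unique vertex, and two gaps are corners of the same vertex iff the same edges pass over them;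
-- this relation is noncrossing because edges do not cross.  A parity count (closed intervals of
-- a noncrossing matching have even length) shows that a gap is even iff its vertex is, and the
-- even gap 2k is the corner just before the side 2k + 1 that puts k + 1 into the block of its
-- vertex; so ρ(T) is the relation restricted to even gaps.  Rerooting shifts every gap by one,
-- so ρ(φ T) is the relation on odd gaps, and on the interleaved order ρ(T) ∪ ρ(φ T) is the whole
-- relation, hence noncrossing.  It is the coarsest such: if a noncrossing Q′ joined two odd gaps
-- separated by an edge, the even gaps at the ends of that edge would form a crossing block of ρ(T).

module Submission where

open import Defs
open import Data.Nat using (ℕ; zero; suc; _+_; _*_; _∸_; _≤_; _<_; z≤n; s≤s; _%_; _/_; _≤?_; _<?_)
open import Data.Nat.Properties
open import Data.Nat.DivMod using (m*n/n≡m)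
open import Data.Nat.Induction using (<-wellFounded)
open import Induction.WellFounded using (Acc; acc)
open import Data.Bool using (Bool; true; false; not; _xor_; if_then_else_)
open import Data.Bool.Properties using (not-injective; not-involutive; xor-same)
open import Data.Fin using (Fin; toℕ; fromℕ<)
open import Data.Fin.Properties using (toℕ-fromℕ<; toℕ<n)
open import Data.Product using (_×_; _,_; proj₁; proj₂; ∃-syntax; ∃₂)
open import Data.Sum using (_⊎_; inj₁; inj₂; map)
open import Data.Empty using (⊥; ⊥-elim)
open import Data.Unit using (⊤; tt)
open import Data.List.Relation.Unary.Any using (any?)
open import Data.List.Membership.Propositional using (_∈_; find; lose)
open import Data.List.Membership.Propositional.Properties using (∈-map⁺; ∈-map⁻)
open import Function using (case_of_; _∘_; id)
open import Function.Bundles using (_⇔_; mk⇔; Equivalence)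
open import Function.Properties.Equivalence using (⇔-isEquivalence)
open import Relation.Nullary using (¬_; Dec; yes; no)
open import Relation.Nullary.Decidable using (_×-dec_; decidable-stable)
open import Relation.Binary.PropositionalEquality
open import Relation.Binary.Definitions using (tri<; tri≈; tri>)
open import Relation.Binary.Structures using (IsEquivalence)

open Equivalence using (to; from)
private module ⇔ {a} = IsEquivalence (⇔-isEquivalence {a})

odd : ℕ → Bool
odd zero          = false
odd (suc zero)    = true
odd (suc (suc m)) = odd m

odd-suc : ∀ m → odd (suc m) ≡ not (odd m)
odd-suc zero          = refl
odd-suc (suc zero)    = refl
odd-suc (suc (suc m)) = odd-suc m

odd-+ : ∀ m n → odd (m + n) ≡ odd m xor odd n
odd-+ zero          n = refl
odd-+ (suc zero)    n = odd-suc n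
odd-+ (suc (suc m)) n = odd-+ m n

odd-2* : ∀ m → odd (2 * m) ≡ false
odd-2* m = begin
  odd (m + (m + 0))    ≡⟨ cong (λ k → odd (m + k)) (+-identityʳ m) ⟩
  odd (m + m)          ≡⟨ odd-+ m m ⟩
  odd m xor odd m      ≡⟨ xor-same (odd m) ⟩
  false                ∎
  where open ≡-Reasoning

odd-1+2* : ∀ m → odd (suc (2 * m)) ≡ true
odd-1+2* m = trans (odd-suc (2 * m)) (cong not (odd-2* m))

m%2≡odd : ∀ m → m % 2 ≡ (if odd m then 1 else 0)
m%2≡odd zero          = refl
m%2≡odd (suc zero)    = refl
m%2≡odd (suc (suc m)) = m%2≡odd m

even⇒≡2* : ∀ m → odd m ≡ false → ∃[ k ] m ≡ 2 * k
even⇒≡2* zero          _ = 0 , refl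
even⇒≡2* (suc (suc m)) p with even⇒≡2* m p
... | k , refl = suc k , cong suc (sym (+-suc k (k + 0)))

odd⇒≡1+2* : ∀ m → odd m ≡ true → ∃[ k ] m ≡ suc (2 * k)
odd⇒≡1+2* (suc zero)    _ = 0 , refl
odd⇒≡1+2* (suc (suc m)) p with odd⇒≡1+2* m p
... | k , refl = suc k , cong (λ z → suc (suc z)) (sym (+-suc k (k + 0)))

even⇔%2≡0 : ∀ m → odd m ≡ false ⇔ IsEvenℕ m
even⇔%2≡0 m with odd m | m%2≡odd m
... | false | eq = mk⇔ (λ _ → eq) (λ _ → refl)
... | true  | eq = mk⇔ (λ ()) (λ eq′ → case trans (sym eq) eq′ of λ ())

oddIndex-odd : ∀ {i j} → odd i ≡ true → oddIndex (i , j) ≡ i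
oddIndex-odd {i} p rewrite m%2≡odd i | p = refl

oddIndex-even : ∀ {i j} → odd i ≡ false → oddIndex (i , j) ≡ j
oddIndex-even {i} p rewrite m%2≡odd i | p = refl

[1+2k+1]/2≡1+k : ∀ k → (suc (2 * k) + 1) / 2 ≡ suc k
[1+2k+1]/2≡1+k k = begin
  (suc (2 * k) + 1) / 2  ≡⟨ cong (_/ 2) (+-comm (suc (2 * k)) 1) ⟩
  (2 + 2 * k) / 2        ≡⟨ cong (λ m → (2 + m) / 2) (*-comm 2 k) ⟩
  (suc k * 2) / 2        ≡⟨ m*n/n≡m (suc k) 2 ⟩
  suc k                  ∎
  where open ≡-Reasoning

even≤odd⇒< : ∀ s x → 2 * s ≤ suc (2 * x) → 2 * s < suc (2 * x)
even≤odd⇒< s x le = ≤∧≢⇒< le (even≢odd s x)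

odd≤even⇒< : ∀ x t → suc (2 * x) ≤ 2 * t → suc (2 * x) < 2 * t
odd≤even⇒< x t le = ≤∧≢⇒< le (even≢odd t x ∘ sym)

toFin : ∀ {n s} → s < n → ∃[ k ] toℕ {n} k ≡ s
toFin s<n = fromℕ< s<n , toℕ-fromℕ< s<n

⇔-cong : ∀ {a} {A B C D : Set a} → A ⇔ B → C ⇔ D → (A ⇔ C) ⇔ (B ⇔ D)
⇔-cong A⇔B C⇔D = mk⇔ (λ A⇔C → ⇔.trans (⇔.sym A⇔B) (⇔.trans A⇔C C⇔D))
                     (λ B⇔D → ⇔.trans A⇔B (⇔.trans B⇔D (⇔.sym C⇔D)))

⇔-cong-¬ : ∀ {a} {A B C D : Set a} → Dec B → Dec D → A ⇔ (¬ B) → C ⇔ (¬ D) → (A ⇔ C) ⇔ (B ⇔ D)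
⇔-cong-¬ B? D? A⇔¬B C⇔¬D = mk⇔
  (λ A⇔C → mk⇔ (λ b → decidable-stable D? λ ¬d → to A⇔¬B (from A⇔C (from C⇔¬D ¬d)) b)
               (λ d → decidable-stable B? λ ¬b → to C⇔¬D (to A⇔C (from A⇔¬B ¬b)) d))
  (λ B⇔D → mk⇔ (λ a → from C⇔¬D λ d → to A⇔¬B a (from B⇔D d))
               (λ c → from A⇔¬B λ b → to C⇔¬D c (to B⇔D b)))

-- Gap x sits between the edge-sides x and x + 1; gap 0 is the corner at the
-- root before the first side.
Covers : Edge → ℕ → Set
Covers (i , j) x = i ≤ x × x < j

covers? : ∀ h x → Dec (Covers h x)
covers? (i , j) x = (i ≤? x) ×-dec (x <? j)

uncovered⇒outside : ∀ {i j w} → ¬ Covers (i , j) w → w < i ⊎ j ≤ w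
uncovered⇒outside {i} {j} {w} uncovered with w <? i
... | yes w<i = inj₁ w<i
... | no  w≮i = inj₂ (≮⇒≥ λ w<j → uncovered (≮⇒≥ w≮i , w<j))

_⊏?_ : ∀ e f → Dec (e ⊏ f)
e ⊏? f = (proj₁ f <? proj₁ e) ×-dec (proj₂ e <? proj₂ f)

⊏-trans : ∀ {e f g} → e ⊏ f → f ⊏ g → e ⊏ g
⊏-trans (f₁<e₁ , e₂<f₂) (g₁<f₁ , f₂<g₂) = <-trans g₁<f₁ f₁<e₁ , <-trans e₂<f₂ f₂<g₂

AtOrAbove : Edge → Edge → Set
AtOrAbove e h = h ≡ e ⊎ e ⊏ h

SharesEndpoint : Edge → Edge → Set
SharesEndpoint (i , j) (k , l) = i ≡ k ⊎ i ≡ l ⊎ j ≡ k ⊎ j ≡ l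

SharesEndpoint-sym : ∀ {e f} → SharesEndpoint e f → SharesEndpoint f e
SharesEndpoint-sym (inj₁ i≡k)               = inj₁ (sym i≡k)
SharesEndpoint-sym (inj₂ (inj₁ i≡l))        = inj₂ (inj₂ (inj₁ (sym i≡l)))
SharesEndpoint-sym (inj₂ (inj₂ (inj₁ j≡k))) = inj₂ (inj₁ (sym j≡k))
SharesEndpoint-sym (inj₂ (inj₂ (inj₂ j≡l))) = inj₂ (inj₂ (inj₂ (sym j≡l)))

SharesEndpoint-suc : ∀ {i j k l} → SharesEndpoint (i , j) (k , l) →
                     SharesEndpoint (suc i , suc j) (suc k , suc l)
SharesEndpoint-suc = map (cong suc) (map (cong suc) (map (cong suc) (cong suc)))

Closed : PairSet → ℕ → ℕ → Set
Closed T i j = ∀ {p q} → (p , q) ∈ T → Covers (i , j) p ⇔ Covers (i , j) q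

-- Two gaps are corners of the same vertex iff the same edges pass over them.
SameVertex : PairSet → ℕ → ℕ → Set
SameVertex T x y = ∀ h → h ∈ T → Covers h x ⇔ Covers h y

SameVertex-isEquivalence : ∀ {T} → IsEquivalence (SameVertex T)
SameVertex-isEquivalence = record
  { refl  = λ h _ → ⇔.refl
  ; sym   = λ r h h∈ → ⇔.sym (r h h∈)
  ; trans = λ r s h h∈ → ⇔.trans (r h h∈) (s h h∈)
  }

private module ~ {T} = IsEquivalence (SameVertex-isEquivalence {T})

SameVertex-noncrossing : ∀ {T a b c d} → a < b → b < c → c < d →
                         SameVertex T a c → SameVertex T b d → SameVertex T a b
SameVertex-noncrossing {a = a} {b} {c} {d} a<b b<c c<d a~c b~d (i , j) h∈ = mk⇔ a⇒b b⇒a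
  where
  a⇒b : Covers (i , j) a → Covers (i , j) b
  a⇒b (i≤a , a<j) = ≤-trans i≤a (<⇒≤ a<b) , <-trans b<c (proj₂ (to (a~c (i , j) h∈) (i≤a , a<j)))
  b⇒a : Covers (i , j) b → Covers (i , j) a
  b⇒a (i≤b , b<j) = from (a~c (i , j) h∈)
    (≤-trans i≤b (<⇒≤ b<c) , <-trans c<d (proj₂ (to (b~d (i , j) h∈) (i≤b , b<j))))

module _ {A : Set} {T : PairSet} (f : A → ℕ) {R : A → A → Set}
         (R⇔ : ∀ a b → R a b ⇔ SameVertex T (f a) (f b)) where

  pullback-isEquivalence : IsEquivalence R
  pullback-isEquivalence = record
    { refl  = from (R⇔ _ _) ~.refl
    ; sym   = λ r → from (R⇔ _ _) (~.sym (to (R⇔ _ _) r))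
    ; trans = λ r s → from (R⇔ _ _) (~.trans (to (R⇔ _ _) r) (to (R⇔ _ _) s))
    }

  pullback-noncrossing : (pos : A → ℕ) → (∀ {a b} → pos a < pos b → f a < f b) → NonCrossing pos R
  pullback-noncrossing pos mono a b c d a<b b<c c<d Rac Rbd ¬Rab = ¬Rab (from (R⇔ a b)
    (SameVertex-noncrossing (mono a<b) (mono b<c) (mono c<d) (to (R⇔ a c) Rac) (to (R⇔ b d) Rbd)))

module PlaneTree {n : ℕ} {T : PairSet} (pt : IsPlaneTree n T) where
  open IsPlaneTree pt

  1≤left : ∀ {i j} → (i , j) ∈ T → 1 ≤ i
  1≤left e∈ = proj₁ (ordered e∈)

  left<right : ∀ {i j} → (i , j) ∈ T → i < j
  left<right e∈ = proj₁ (proj₂ (ordered e∈))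

  right≤2n : ∀ {i j} → (i , j) ∈ T → j ≤ 2 * n
  right≤2n e∈ = proj₂ (proj₂ (ordered e∈))

  left-unique : ∀ {a b c d} → (a , b) ∈ T → (c , d) ∈ T → a ≡ c → b ≡ d
  left-unique e∈ f∈ a≡c = cong proj₂ (disjoint e∈ f∈ (inj₁ a≡c))

  right-unique : ∀ {a b c d} → (a , b) ∈ T → (c , d) ∈ T → b ≡ d → a ≡ c
  right-unique e∈ f∈ b≡d = cong proj₁ (disjoint e∈ f∈ (inj₂ (inj₂ (inj₂ b≡d))))

  left≢right : ∀ {a b c d} → (a , b) ∈ T → (c , d) ∈ T → a ≢ d
  left≢right {a} {b} e∈ f∈ a≡d with disjoint e∈ f∈ (inj₂ (inj₁ a≡d))
  ... | refl = <-irrefl a≡d (left<right e∈)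

  right≢left : ∀ {a b c d} → (a , b) ∈ T → (c , d) ∈ T → b ≢ c
  right≢left e∈ f∈ b≡c = left≢right f∈ e∈ (sym b≡c)

  closed-inside : ∀ {a b} → (a , b) ∈ T → Closed T (suc a) b
  closed-inside {a} {b} ab∈ {p} {q} pq∈ = mk⇔ p⇒q q⇒p
    where
    p⇒q : Covers (suc a , b) p → Covers (suc a , b) q
    p⇒q (a<p , p<b) with <-cmp q b
    ... | tri< q<b _ _ = <-trans a<p (left<right pq∈) , q<b
    ... | tri≈ _ q≡b _ = ⊥-elim (<-irrefl (right-unique ab∈ pq∈ (sym q≡b)) a<p)
    ... | tri> _ _ b<q = ⊥-elim (noncrossing ab∈ pq∈ a<p p<b b<q)
    q⇒p : Covers (suc a , b) q → Covers (suc a , b) p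
    q⇒p (a<q , q<b) with <-cmp p a
    ... | tri< p<a _ _ = ⊥-elim (noncrossing pq∈ ab∈ p<a a<q q<b)
    ... | tri≈ _ p≡a _ = ⊥-elim (<-irrefl (left-unique pq∈ ab∈ p≡a) q<b)
    ... | tri> _ _ a<p = a<p , <-trans (left<right pq∈) q<b

  closed-after : ∀ {l j k} → Closed T l j → (l , k) ∈ T → Closed T (suc k) j
  closed-after {l} {j} {k} cl lk∈ {p} {q} pq∈ = mk⇔ p⇒q q⇒p
    where
    p⇒q : Covers (suc k , j) p → Covers (suc k , j) q
    p⇒q (k<p , p<j) = <-trans k<p (left<right pq∈) ,
      proj₂ (to (cl pq∈) (<⇒≤ (<-trans (left<right lk∈) k<p) , p<j))
    q⇒p : Covers (suc k , j) q → Covers (suc k , j) p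
    q⇒p (k<q , q<j) with from (cl pq∈) (<⇒≤ (<-trans (left<right lk∈) k<q) , q<j)
    ... | l≤p , _ with <-cmp p k
    ...   | tri> _ _ k<p = k<p , <-trans (left<right pq∈) q<j
    ...   | tri≈ _ p≡k _ = ⊥-elim (left≢right pq∈ lk∈ p≡k)
    ...   | tri< p<k _ _ with m≤n⇒m<n∨m≡n l≤p
    ...     | inj₁ l<p = ⊥-elim (noncrossing lk∈ pq∈ l<p p<k k<q)
    ...     | inj₂ l≡p = ⊥-elim (<-irrefl (left-unique lk∈ pq∈ l≡p) k<q)

  -- Every closed interval has even length: it is tiled by the edge starting
  -- at its left end, the interval inside that edge, and the interval after it.
  closed-parity : ∀ {i j} → 1 ≤ i → i ≤ j → j ≤ suc (2 * n) → Closed T i j → odd j ≡ odd i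
  closed-parity {i} {j} = go (<-wellFounded (j ∸ i))
    where
    go : ∀ {i j} → Acc _<_ (j ∸ i) → 1 ≤ i → i ≤ j → j ≤ suc (2 * n) → Closed T i j → odd j ≡ odd i
    go {i} {j} (acc rec) 1≤i i≤j j≤ cl with m≤n⇒m<n∨m≡n i≤j
    ... | inj₂ refl = refl
    ... | inj₁ i<j with covers i 1≤i (≤-pred (≤-trans i<j j≤))
    ...   | (p , .i) , p∈ , inj₂ refl =
            ⊥-elim (<-irrefl refl (<-≤-trans (left<right p∈) (proj₁ (from (cl p∈) (≤-refl , i<j)))))
    ...   | (.i , q) , q∈ , inj₁ refl = begin
            odd j             ≡⟨ go (rec after<) (s≤s z≤n) q<j j≤ (closed-after cl q∈) ⟩
            odd (suc q)       ≡⟨ odd-suc q ⟩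
            not (odd q)       ≡⟨ cong not (go (rec inside<) (s≤s z≤n) i<q
                                   (≤-trans (<⇒≤ q<j) j≤) (closed-inside q∈)) ⟩
            not (odd (suc i)) ≡⟨ cong not (odd-suc i) ⟩
            not (not (odd i)) ≡⟨ not-involutive (odd i) ⟩
            odd i             ∎
      where
      open ≡-Reasoning
      q<j : q < j
      q<j = proj₂ (to (cl q∈) (≤-refl , i<j))
      i<q : suc i ≤ q
      i<q = left<right q∈
      after< : j ∸ suc q < j ∸ i
      after< = ∸-monoʳ-< (<-trans (left<right q∈) (n<1+n q)) q<j
      inside< : q ∸ suc i < j ∸ i
      inside< = <-≤-trans (∸-monoʳ-< (n<1+n i) i<q) (∸-monoˡ-≤ i (<⇒≤ q<j))

  closed-before-top : ∀ {a b} → (suc a , b) ∈ T → TopEdge T (suc a , b) → Closed T 1 (suc a)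
  closed-before-top {a} {b} ab∈ top {p} {q} pq∈ = mk⇔ p⇒q q⇒p
    where
    p⇒q : Covers (1 , suc a) p → Covers (1 , suc a) q
    p⇒q (1≤p , p≤a) with <-cmp q (suc a)
    ... | tri< q≤a _ _ = ≤-trans 1≤p (<⇒≤ (left<right pq∈)) , q≤a
    ... | tri≈ _ q≡1+a _ = ⊥-elim (right≢left pq∈ ab∈ q≡1+a)
    ... | tri> _ _ a<q with <-cmp q b
    ...   | tri< q<b _ _ = ⊥-elim (noncrossing pq∈ ab∈ p≤a a<q q<b)
    ...   | tri≈ _ q≡b _ = ⊥-elim (<-irrefl (right-unique pq∈ ab∈ q≡b) p≤a)
    ...   | tri> _ _ b<q = ⊥-elim (top (p , q) pq∈ (p≤a , b<q))
    q⇒p : Covers (1 , suc a) q → Covers (1 , suc a) p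
    q⇒p (_ , q≤a) = 1≤left pq∈ , <-trans (left<right pq∈) q≤a

  closed-before-child : ∀ {a b c d} → (a , b) ∈ T → ParentEdge T (a , b) (c , d) → Closed T (suc c) a
  closed-before-child {a} {b} {c} {d} ab∈ (cd∈ , (c<a , b<d) , innermost) {p} {q} pq∈ = mk⇔ p⇒q q⇒p
    where
    a<d : a < d
    a<d = <-trans (left<right ab∈) b<d
    p⇒q : Covers (suc c , a) p → Covers (suc c , a) q
    p⇒q (c<p , p<a) with <-cmp q a
    ... | tri< q<a _ _ = <-trans c<p (left<right pq∈) , q<a
    ... | tri≈ _ q≡a _ = ⊥-elim (right≢left pq∈ ab∈ q≡a)
    ... | tri> _ _ a<q with <-cmp q b
    ...   | tri< q<b _ _ = ⊥-elim (noncrossing pq∈ ab∈ p<a a<q q<b)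
    ...   | tri≈ _ q≡b _ = ⊥-elim (<-irrefl (right-unique pq∈ ab∈ q≡b) p<a)
    ...   | tri> _ _ b<q with <-cmp q d
    ...     | tri< q<d _ _ = ⊥-elim (innermost (p , q) pq∈ (p<a , b<q) (c<p , q<d))
    ...     | tri≈ _ q≡d _ = ⊥-elim (<-irrefl (sym (right-unique pq∈ cd∈ q≡d)) c<p)
    ...     | tri> _ _ d<q = ⊥-elim (noncrossing cd∈ pq∈ c<p (<-trans p<a a<d) d<q)
    q⇒p : Covers (suc c , a) q → Covers (suc c , a) p
    q⇒p (c<q , q<a) with <-cmp p c
    ... | tri< p<c _ _ = ⊥-elim (noncrossing pq∈ cd∈ p<c c<q (<-trans q<a a<d))
    ... | tri≈ _ p≡c _ = ⊥-elim (<-irrefl (left-unique pq∈ cd∈ p≡c) (<-trans q<a a<d))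
    ... | tri> _ _ c<p = c<p , <-trans (left<right pq∈) q<a

  left≤1+2n : ∀ {i j} → (i , j) ∈ T → i ≤ suc (2 * n)
  left≤1+2n e∈ = ≤-trans (<⇒≤ (<-≤-trans (left<right e∈) (right≤2n e∈))) (n≤1+n _)

  odd-right : ∀ {a b} → (a , b) ∈ T → odd b ≡ not (odd a)
  odd-right {a} ab∈ = trans
    (closed-parity (s≤s z≤n) (left<right ab∈) (≤-trans (right≤2n ab∈) (n≤1+n _)) (closed-inside ab∈))
    (odd-suc a)

  odd-top : ∀ {a b} → (a , b) ∈ T → TopEdge T (a , b) → odd a ≡ true
  odd-top {zero}  ab∈ _   = ⊥-elim (<-irrefl refl (1≤left ab∈))
  odd-top {suc a} ab∈ top = closed-parity (s≤s z≤n) (s≤s z≤n) (left≤1+2n ab∈) (closed-before-top ab∈ top)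

  odd-child : ∀ {a b c d} → (a , b) ∈ T → ParentEdge T (a , b) (c , d) → odd a ≡ not (odd c)
  odd-child {c = c} ab∈ pe@(_ , (c<a , _) , _) = trans
    (closed-parity (s≤s z≤n) c<a (left≤1+2n ab∈) (closed-before-child ab∈ pe))
    (odd-suc c)

  enclosers-nested : ∀ {g e f} → g ∈ T → e ∈ T → f ∈ T → g ⊏ e → g ⊏ f → e ≡ f ⊎ e ⊏ f ⊎ f ⊏ e
  enclosers-nested {a , b} {p , q} {p′ , q′} g∈ e∈ f∈ (p<a , b<q) (p′<a , b<q′) with <-cmp p p′
  ... | tri≈ _ refl _ = inj₁ (cong (p ,_) (left-unique e∈ f∈ refl))
  ... | tri< p<p′ _ _ with <-cmp q q′
  ...   | tri< q<q′ _ _ = ⊥-elim (noncrossing e∈ f∈ p<p′ (<-trans p′<a (<-trans (left<right g∈) b<q)) q<q′)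
  ...   | tri≈ _ q≡q′ _ = ⊥-elim (<-irrefl (right-unique e∈ f∈ q≡q′) p<p′)
  ...   | tri> _ _ q′<q = inj₂ (inj₂ (p<p′ , q′<q))
  enclosers-nested {a , b} {p , q} {p′ , q′} g∈ e∈ f∈ (p<a , b<q) (p′<a , b<q′) | tri> _ _ p′<p
    with <-cmp q q′
  ...   | tri< q<q′ _ _ = inj₂ (inj₁ (p′<p , q<q′))
  ...   | tri≈ _ q≡q′ _ = ⊥-elim (<-irrefl (sym (right-unique e∈ f∈ q≡q′)) p′<p)
  ...   | tri> _ _ q′<q = ⊥-elim (noncrossing f∈ e∈ p′<p (<-trans p<a (<-trans (left<right g∈) b<q′)) q′<q)

  parent-exists : ∀ {g f} → f ∈ T → g ⊏ f → ∃[ e ] ParentEdge T g e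
  parent-exists {g} {f} = go (<-wellFounded (proj₁ g ∸ proj₁ f))
    where
    go : ∀ {f} → Acc _<_ (proj₁ g ∸ proj₁ f) → f ∈ T → g ⊏ f → ∃[ e ] ParentEdge T g e
    go {f} (acc rec) f∈ g⊏f with any? (λ h → (g ⊏? h) ×-dec (h ⊏? f)) T
    ... | no ¬between = f , f∈ , g⊏f , λ h h∈ g⊏h h⊏f → ¬between (lose h∈ (g⊏h , h⊏f))
    ... | yes between with find between
    ...   | h , h∈ , (g⊏h , h⊏f) = go (rec (∸-monoʳ-< (proj₁ h⊏f) (<⇒≤ (proj₁ g⊏h)))) h∈ g⊏h

  encloses⇔atOrAbove-parent : ∀ {g e h} → g ∈ T → ParentEdge T g e → h ∈ T → g ⊏ h ⇔ AtOrAbove e h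
  encloses⇔atOrAbove-parent g∈ (e∈ , g⊏e , innermost) h∈ = mk⇔ ⇒ ⇐
    where
    ⇒ = λ g⊏h → case enclosers-nested g∈ h∈ e∈ g⊏h g⊏e of λ where
      (inj₁ h≡e)        → inj₁ h≡e
      (inj₂ (inj₁ h⊏e)) → ⊥-elim (innermost _ h∈ g⊏h h⊏e)
      (inj₂ (inj₂ e⊏h)) → inj₂ e⊏h
    ⇐ = λ where
      (inj₁ refl) → g⊏e
      (inj₂ e⊏h)  → ⊏-trans g⊏e e⊏h

  covers-before⇔encloses : ∀ {x b h} → (suc x , b) ∈ T → h ∈ T → Covers h x ⇔ (suc x , b) ⊏ h
  covers-before⇔encloses {x} {b} {p , q} g∈ h∈ = mk⇔ ⇒ ⇐
    where
    ⇒ : Covers (p , q) x → (suc x , b) ⊏ (p , q)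
    ⇒ (p≤x , x<q) with m≤n⇒m<n∨m≡n x<q
    ... | inj₂ 1+x≡q = ⊥-elim (right≢left h∈ g∈ (sym 1+x≡q))
    ... | inj₁ 1+x<q with <-cmp q b
    ...   | tri< q<b _ _ = ⊥-elim (noncrossing h∈ g∈ (s≤s p≤x) 1+x<q q<b)
    ...   | tri≈ _ q≡b _ = ⊥-elim (<-irrefl (right-unique h∈ g∈ q≡b) (s≤s p≤x))
    ...   | tri> _ _ b<q = s≤s p≤x , b<q
    ⇐ : (suc x , b) ⊏ (p , q) → Covers (p , q) x
    ⇐ (p<1+x , b<q) = ≤-pred p<1+x , <-trans (n<1+n x) (<-trans (left<right g∈) b<q)

  covers-after⇔encloses : ∀ {a b h} → (a , b) ∈ T → h ∈ T → Covers h b ⇔ (a , b) ⊏ h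
  covers-after⇔encloses {a} {b} {p , q} g∈ h∈ = mk⇔ ⇒ ⇐
    where
    ⇒ : Covers (p , q) b → (a , b) ⊏ (p , q)
    ⇒ (p≤b , b<q) with m≤n⇒m<n∨m≡n p≤b
    ... | inj₂ p≡b = ⊥-elim (left≢right h∈ g∈ p≡b)
    ... | inj₁ p<b with <-cmp p a
    ...   | tri< p<a _ _ = p<a , b<q
    ...   | tri≈ _ p≡a _ = ⊥-elim (<-irrefl (sym (left-unique h∈ g∈ p≡a)) b<q)
    ...   | tri> _ _ a<p = ⊥-elim (noncrossing g∈ h∈ a<p p<b b<q)
    ⇐ : (a , b) ⊏ (p , q) → Covers (p , q) b
    ⇐ (p<a , b<q) = <⇒≤ (<-trans p<a (left<right g∈)) , b<q

  covers-first⇔atOrAbove : ∀ {a b h} → (a , b) ∈ T → h ∈ T → Covers h a ⇔ AtOrAbove (a , b) h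
  covers-first⇔atOrAbove {a} {b} {p , q} g∈ h∈ = mk⇔ ⇒ ⇐
    where
    ⇒ : Covers (p , q) a → AtOrAbove (a , b) (p , q)
    ⇒ (p≤a , a<q) with m≤n⇒m<n∨m≡n p≤a
    ... | inj₂ p≡a = inj₁ (cong₂ _,_ p≡a (left-unique h∈ g∈ p≡a))
    ... | inj₁ p<a with <-cmp q b
    ...   | tri< q<b _ _ = ⊥-elim (noncrossing h∈ g∈ p<a a<q q<b)
    ...   | tri≈ _ q≡b _ = ⊥-elim (<-irrefl (right-unique h∈ g∈ q≡b) p<a)
    ...   | tri> _ _ b<q = inj₂ (p<a , b<q)
    ⇐ : AtOrAbove (a , b) (p , q) → Covers (p , q) a
    ⇐ (inj₁ refl)        = ≤-refl , left<right g∈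
    ⇐ (inj₂ (p<a , b<q)) = <⇒≤ p<a , <-trans (left<right g∈) b<q

  covers-last⇔atOrAbove : ∀ {a x h} → (a , suc x) ∈ T → h ∈ T → Covers h x ⇔ AtOrAbove (a , suc x) h
  covers-last⇔atOrAbove {a} {x} {p , q} g∈ h∈ = mk⇔ ⇒ ⇐
    where
    ⇒ : Covers (p , q) x → AtOrAbove (a , suc x) (p , q)
    ⇒ (p≤x , x<q) with m≤n⇒m<n∨m≡n x<q
    ... | inj₂ 1+x≡q = inj₁ (cong₂ _,_ (right-unique h∈ g∈ (sym 1+x≡q)) (sym 1+x≡q))
    ... | inj₁ 1+x<q with <-cmp p a
    ...   | tri< p<a _ _ = inj₂ (p<a , 1+x<q)
    ...   | tri≈ _ p≡a _ = ⊥-elim (<-irrefl (sym (left-unique h∈ g∈ p≡a)) 1+x<q)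
    ...   | tri> _ _ a<p = ⊥-elim (noncrossing g∈ h∈ a<p (s≤s p≤x) 1+x<q)
    ⇐ : AtOrAbove (a , suc x) (p , q) → Covers (p , q) x
    ⇐ (inj₁ refl)          = ≤-pred (left<right g∈) , ≤-refl
    ⇐ (inj₂ (p<a , 1+x<q)) = ≤-pred (<-trans p<a (left<right g∈)) , <-trans (n<1+n x) 1+x<q

  covers-before-top : ∀ {x b h} → (suc x , b) ∈ T → TopEdge T (suc x , b) → h ∈ T → ¬ Covers h x
  covers-before-top g∈ top h∈ = top _ h∈ ∘ to (covers-before⇔encloses g∈ h∈)

  covers-before-child⇔atOrAbove : ∀ {x b e h} → (suc x , b) ∈ T → ParentEdge T (suc x , b) e → h ∈ T →
                                  Covers h x ⇔ AtOrAbove e h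
  covers-before-child⇔atOrAbove g∈ pe h∈ =
    ⇔.trans (covers-before⇔encloses g∈ h∈) (encloses⇔atOrAbove-parent g∈ pe h∈)

  Above : Vertex T → Edge → Set
  Above root        _ = ⊥
  Above (below e _) h = AtOrAbove e h

  vertexOdd : Vertex T → Bool
  vertexOdd root        = false
  vertexOdd (below e _) = odd (proj₁ e)

  even-vertex : ∀ v → vertexOdd v ≡ false → EvenVertex v
  even-vertex root              _ = tt
  even-vertex (below (c , _) _) p = to (even⇔%2≡0 c) p

  vertex-even : ∀ v → EvenVertex v → vertexOdd v ≡ false
  vertex-even root              _  = refl
  vertex-even (below (c , _) _) ev = from (even⇔%2≡0 c) ev

  -- For even x the side x + 1 is the odd index of an edge of S_v; this ties gap 2k to the
  -- element k of the block of v in ρ(T).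
  record Corner (x : ℕ) : Set where
    field
      vertex    : Vertex T
      covering  : ∀ {h} → h ∈ T → Covers h x ⇔ Above vertex h
      parity    : vertexOdd vertex ≡ odd x
      edge      : Edge
      edge∈S    : InS T vertex edge
      oddIndex≡ : odd x ≡ false → oddIndex edge ≡ suc x

  corner : ∀ x → x < 2 * n → Corner x
  corner x x<2n with covers (suc x) (s≤s z≤n) x<2n
  ... | (a , .(suc x)) , g∈ , inj₂ refl = record
    { vertex    = below (a , suc x) g∈
    ; covering  = λ h∈ → covers-last⇔atOrAbove g∈ h∈
    ; parity    = a-parity
    ; edge      = a , suc x
    ; edge∈S    = inj₁ refl
    ; oddIndex≡ = λ x-even → oddIndex-even {a} (trans a-parity x-even)
    }
    where
    a-parity : odd a ≡ odd x
    a-parity = not-injective (trans (sym (odd-right g∈)) (odd-suc x))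
  ... | (.(suc x) , b) , g∈ , inj₁ refl with any? (λ f → (suc x , b) ⊏? f) T
  ...   | no ¬enclosed = record
    { vertex    = root
    ; covering  = λ h∈ → mk⇔ (covers-before-top g∈ top h∈) λ ()
    ; parity    = sym (not-injective (trans (sym (odd-suc x)) (odd-top g∈ top)))
    ; edge      = suc x , b
    ; edge∈S    = g∈ , top
    ; oddIndex≡ = λ _ → oddIndex-odd (odd-top g∈ top)
    }
    where
    top : TopEdge T (suc x , b)
    top f f∈ g⊏f = ¬enclosed (lose f∈ g⊏f)
  ...   | yes enclosed with find enclosed
  ...     | f , f∈ , g⊏f with parent-exists f∈ g⊏f
  ...       | (c , d) , pe = record
    { vertex    = below (c , d) (proj₁ pe)
    ; covering  = λ h∈ → covers-before-child⇔atOrAbove g∈ pe h∈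
    ; parity    = not-injective (trans (sym (odd-child g∈ pe)) (odd-suc x))
    ; edge      = suc x , b
    ; edge∈S    = inj₂ (g∈ , pe)
    ; oddIndex≡ = λ x-even → oddIndex-odd (trans (odd-suc x) (cong not x-even))
    }

  covers⇔above : ∀ {v g x} → EvenVertex v → InS T v g → oddIndex g ≡ suc x →
                 ∀ {h} → h ∈ T → Covers h x ⇔ Above v h
  covers⇔above {root} {a , b} _ (g∈ , top) oi h∈
    with trans (sym (oddIndex-odd {a} {b} (odd-top g∈ top))) oi
  ... | refl = mk⇔ (covers-before-top g∈ top h∈) λ ()
  covers⇔above {v@(below (c , d) e∈)} ev (inj₁ refl) oi h∈
    with trans (sym (oddIndex-even {c} {d} (vertex-even v ev))) oi
  ... | refl = covers-last⇔atOrAbove e∈ h∈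
  covers⇔above {v@(below _ _)} {a , b} ev (inj₂ (g∈ , pe)) oi h∈
    with trans (sym (oddIndex-odd {a} {b} (trans (odd-child g∈ pe) (cong not (vertex-even v ev))))) oi
  ... | refl = covers-before-child⇔atOrAbove g∈ pe h∈

  open Corner

  _≈ᵥ_ : Vertex T → Vertex T → Set
  root      ≈ᵥ root      = ⊤
  below e _ ≈ᵥ below f _ = e ≡ f
  _         ≈ᵥ _         = ⊥

  sameAbove⇒≈ᵥ : ∀ v w → (∀ {h} → h ∈ T → Above v h ⇔ Above w h) → v ≈ᵥ w
  sameAbove⇒≈ᵥ root         root         _   = tt
  sameAbove⇒≈ᵥ root         (below e e∈) v≃w = from (v≃w e∈) (inj₁ refl)
  sameAbove⇒≈ᵥ (below e e∈) root         v≃w = to (v≃w e∈) (inj₁ refl)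
  sameAbove⇒≈ᵥ (below e e∈) (below f f∈) v≃w with from (v≃w f∈) (inj₁ refl) | to (v≃w e∈) (inj₁ refl)
  ... | inj₁ f≡e | _        = sym f≡e
  ... | inj₂ _   | inj₁ e≡f = e≡f
  ... | inj₂ e⊏f | inj₂ f⊏e = ⊥-elim (<-asym (proj₁ e⊏f) (proj₁ f⊏e))

  ≈ᵥ⇒vertexOdd : ∀ v w → v ≈ᵥ w → vertexOdd v ≡ vertexOdd w
  ≈ᵥ⇒vertexOdd root        root        _    = refl
  ≈ᵥ⇒vertexOdd (below _ _) (below _ _) refl = refl

  ≈ᵥ⇒InS : ∀ v w {g} → v ≈ᵥ w → InS T w g → InS T v g
  ≈ᵥ⇒InS root        root        _    g∈S = g∈S
  ≈ᵥ⇒InS (below _ _) (below _ _) refl g∈S = g∈S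

  SameVertex⇒≈ᵥ : ∀ {x y} (cx : Corner x) (cy : Corner y) → SameVertex T x y → vertex cx ≈ᵥ vertex cy
  SameVertex⇒≈ᵥ cx cy x~y = sameAbove⇒≈ᵥ _ _ λ {h} h∈ →
    ⇔.trans (⇔.sym (covering cx h∈)) (⇔.trans (x~y h h∈) (covering cy h∈))

  SameVertex-parity : ∀ {x y} → x < 2 * n → y < 2 * n → SameVertex T x y → odd x ≡ odd y
  SameVertex-parity {x} {y} x<2n y<2n x~y = begin
    odd x                 ≡⟨ parity cx ⟨
    vertexOdd (vertex cx) ≡⟨ ≈ᵥ⇒vertexOdd _ _ (SameVertex⇒≈ᵥ cx cy x~y) ⟩
    vertexOdd (vertex cy) ≡⟨ parity cy ⟩
    odd y                 ∎
    where
    open ≡-Reasoning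
    cx = corner x x<2n
    cy = corner y y<2n

  InS⇒∈ : ∀ {v g} → InS T v g → g ∈ T
  InS⇒∈ {root}      (g∈ , _)      = g∈
  InS⇒∈ {below _ e∈} (inj₁ refl)   = e∈
  InS⇒∈ {below _ _}  (inj₂ (g∈ , _)) = g∈

  odd-oddIndex : ∀ {g} → g ∈ T → odd (oddIndex g) ≡ true
  odd-oddIndex {i , j} g∈ with odd i in i-parity
  ... | true  rewrite oddIndex-odd {i} {j} i-parity = i-parity
  ... | false rewrite oddIndex-even {i} {j} i-parity = trans (odd-right g∈) (cong not i-parity)

  oddIndex≡1+2* : ∀ {g} k → g ∈ T → (oddIndex g + 1) / 2 ≡ suc k → oddIndex g ≡ suc (2 * k)
  oddIndex≡1+2* {g} k g∈ half≡ with odd⇒≡1+2* (oddIndex g) (odd-oddIndex g∈)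
  ... | m , oi≡ = trans oi≡ (cong (λ z → suc (2 * z)) m≡k)
    where
    m≡k : m ≡ k
    m≡k = suc-injective (begin
      suc m                    ≡⟨ [1+2k+1]/2≡1+k m ⟨
      (suc (2 * m) + 1) / 2    ≡⟨ cong (λ z → (z + 1) / 2) oi≡ ⟨
      (oddIndex g + 1) / 2     ≡⟨ half≡ ⟩
      suc k                    ∎)
      where open ≡-Reasoning

  2k<2n : (k : Fin n) → 2 * toℕ k < 2 * n
  2k<2n k = *-monoʳ-< 2 (toℕ<n k)

  ρ⇔SameVertex : ∀ k l → ρ n T k l ⇔ SameVertex T (2 * toℕ k) (2 * toℕ l)
  ρ⇔SameVertex k l = mk⇔ ⇒ ⇐
    where
    ⇒ : ρ n T k l → SameVertex T (2 * toℕ k) (2 * toℕ l)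
    ⇒ (v , ev , (g , g∈S , g-block) , (g′ , g′∈S , g′-block)) h h∈ =
      ⇔.trans (covers⇔above ev g∈S (oddIndex≡1+2* (toℕ k) (InS⇒∈ g∈S) g-block) h∈)
              (⇔.sym (covers⇔above ev g′∈S (oddIndex≡1+2* (toℕ l) (InS⇒∈ g′∈S) g′-block) h∈))
    block : ∀ {m} (c : Corner (2 * m)) → (oddIndex (edge c) + 1) / 2 ≡ suc m
    block {m} c rewrite oddIndex≡ c (odd-2* m) = [1+2k+1]/2≡1+k m
    ⇐ : SameVertex T (2 * toℕ k) (2 * toℕ l) → ρ n T k l
    ⇐ k~l = vertex ck , even-vertex _ (trans (parity ck) (odd-2* (toℕ k))) ,
            (edge ck , edge∈S ck , block ck) ,
            (edge cl , ≈ᵥ⇒InS _ _ (SameVertex⇒≈ᵥ ck cl k~l) (edge∈S cl) , block cl)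
      where
      ck = corner _ (2k<2n k)
      cl = corner _ (2k<2n l)

  SameVertex-first-last : ∀ {a x} → (a , suc x) ∈ T → SameVertex T a x
  SameVertex-first-last g∈ h h∈ =
    ⇔.trans (covers-first⇔atOrAbove g∈ h∈) (⇔.sym (covers-last⇔atOrAbove g∈ h∈))

  SameVertex-before-after : ∀ {x b} → (suc x , b) ∈ T → SameVertex T x b
  SameVertex-before-after g∈ h h∈ =
    ⇔.trans (covers-before⇔encloses g∈ h∈) (⇔.sym (covers-after⇔encloses g∈ h∈))

  SameVertex-root-before-last : ∀ {x} → (suc x , 2 * n) ∈ T → SameVertex T 0 x
  SameVertex-root-before-last {x} g∈ (p , q) h∈ = mk⇔ (⊥-elim ∘ uncovered-0) (⊥-elim ∘ uncovered-x)
    where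
    uncovered-0 : ¬ Covers (p , q) 0
    uncovered-0 (p≤0 , _) = <-irrefl refl (≤-trans (1≤left h∈) p≤0)
    uncovered-x : ¬ Covers (p , q) x
    uncovered-x c = <-irrefl refl (<-≤-trans (proj₂ (to (covers-before⇔encloses g∈ h∈) c)) (right≤2n h∈))

  data Start : Edge → Set where
    first-side : ∀ j → Start (1 , suc (suc j))
    later-side : ∀ i j → Start (suc (suc i) , suc j)

  start : ∀ {e} → e ∈ T → Start e
  start {zero , _}               e∈ = ⊥-elim (<-irrefl refl (1≤left e∈))
  start {suc zero , zero}        e∈ = ⊥-elim (<-irrefl refl (<-trans (left<right e∈) (s≤s z≤n)))
  start {suc zero , suc zero}    e∈ = ⊥-elim (<-irrefl refl (left<right e∈))
  start {suc zero , suc (suc j)} e∈ = first-side j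
  start {suc (suc i) , zero}     e∈ = ⊥-elim (<-irrefl refl (<-trans (left<right e∈) (s≤s z≤n)))
  start {suc (suc i) , suc j}    e∈ = later-side i j

  φ-edge∈ : ∀ {e} → e ∈ T → φ-edge n e ∈ φ n T
  φ-edge∈ = ∈-map⁺ (φ-edge n)

  φ-edge-ordered : ∀ {e} → e ∈ T → let (i , j) = φ-edge n e in 1 ≤ i × i < j × j ≤ 2 * n
  φ-edge-ordered e∈ with start e∈
  ... | first-side j   = s≤s z≤n , right≤2n e∈ , ≤-refl
  ... | later-side i j = s≤s z≤n , ≤-pred (left<right e∈) , ≤-trans (n≤1+n j) (right≤2n e∈)

  φ-covers : ∀ m → 1 ≤ m → m ≤ 2 * n → ∃[ e ] (e ∈ φ n T × (proj₁ e ≡ m ⊎ proj₂ e ≡ m))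
  φ-covers (suc m) _ m<2n with m≤n⇒m<n∨m≡n m<2n
  ... | inj₂ 1+m≡2n with covers 1 (s≤s z≤n) (≤-trans (s≤s z≤n) m<2n)
  ...   | (.1 , q) , e∈ , inj₁ refl = _ , φ-edge∈ e∈ , inj₂ (sym 1+m≡2n)
  ...   | (p , .1) , e∈ , inj₂ refl = ⊥-elim (<-irrefl refl (<-≤-trans (left<right e∈) (1≤left e∈)))
  φ-covers (suc m) _ _ | inj₁ m<2n with covers (suc (suc m)) (s≤s z≤n) m<2n
  ... | (._ , q) , e∈ , inj₁ refl = _ , φ-edge∈ e∈ , inj₁ refl
  ... | (p , ._) , e∈ , inj₂ refl with start e∈
  ...   | first-side _   = _ , φ-edge∈ e∈ , inj₁ refl
  ...   | later-side _ _ = _ , φ-edge∈ e∈ , inj₂ refl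

  first-later-disjoint : ∀ {j k l} → (1 , suc (suc j)) ∈ T → (suc (suc k) , suc l) ∈ T →
                         SharesEndpoint (suc j , 2 * n) (suc k , l) →
                         (1 , suc (suc j)) ≡ (suc (suc k) , suc l)
  first-later-disjoint e∈ f∈ (inj₁ 1+j≡1+k)          = disjoint e∈ f∈ (inj₂ (inj₂ (inj₁ (cong suc 1+j≡1+k))))
  first-later-disjoint e∈ f∈ (inj₂ (inj₁ 1+j≡l))      = disjoint e∈ f∈ (inj₂ (inj₂ (inj₂ (cong suc 1+j≡l))))
  first-later-disjoint e∈ f∈ (inj₂ (inj₂ (inj₁ 2n≡k))) =
    ⊥-elim (<-irrefl (sym 2n≡k) (≤-trans (<⇒≤ (left<right f∈)) (right≤2n f∈)))
  first-later-disjoint e∈ f∈ (inj₂ (inj₂ (inj₂ 2n≡l))) = ⊥-elim (<-irrefl (sym 2n≡l) (right≤2n f∈))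

  φ-edge-disjoint : ∀ {e f} → e ∈ T → f ∈ T → SharesEndpoint (φ-edge n e) (φ-edge n f) → e ≡ f
  φ-edge-disjoint e∈ f∈ shared with start e∈ | start f∈
  ... | first-side _   | first-side _   = disjoint e∈ f∈ (inj₁ refl)
  ... | later-side _ _ | later-side _ _ = disjoint e∈ f∈ (SharesEndpoint-suc shared)
  ... | first-side _   | later-side _ _ = first-later-disjoint e∈ f∈ shared
  ... | later-side _ _ | first-side _   = sym (first-later-disjoint f∈ e∈ (SharesEndpoint-sym shared))

  φ-edge-noncrossing : ∀ {e f} → e ∈ T → f ∈ T →
                       let (i , j) = φ-edge n e; (k , l) = φ-edge n f in i < k → k < j → j < l → ⊥
  φ-edge-noncrossing e∈ f∈ i<k k<j j<l with start e∈ | start f∈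
  ... | first-side _   | _              = <-irrefl refl (<-≤-trans j<l (proj₂ (proj₂ (φ-edge-ordered f∈))))
  ... | later-side _ _ | first-side _   = noncrossing f∈ e∈ (s≤s (s≤s z≤n)) (s≤s i<k) (s≤s k<j)
  ... | later-side _ _ | later-side _ _ = noncrossing e∈ f∈ (s≤s i<k) (s≤s k<j) (s≤s j<l)

  φ-isPlaneTree : IsPlaneTree n (φ n T)
  φ-isPlaneTree = record
    { ordered     = λ e′∈ → case ∈-map⁻ (φ-edge n) e′∈ of λ where
        (e , e∈ , refl) → φ-edge-ordered e∈
    ; covers      = φ-covers
    ; disjoint    = λ e′∈ f′∈ shared → case ∈-map⁻ (φ-edge n) e′∈ , ∈-map⁻ (φ-edge n) f′∈ of λ where
        ((e , e∈ , refl) , (f , f∈ , refl)) → cong (φ-edge n) (φ-edge-disjoint e∈ f∈ shared)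
    ; noncrossing = λ e′∈ f′∈ → case ∈-map⁻ (φ-edge n) e′∈ , ∈-map⁻ (φ-edge n) f′∈ of λ where
        ((e , e∈ , refl) , (f , f∈ , refl)) → φ-edge-noncrossing e∈ f∈
    }

  -- The edge at the first side wraps around to end at side 2n, so it covers
  -- exactly the gaps the old edge did not; every other edge moves one step back.
  φ-edge-covers : ∀ {h x y} → h ∈ T → x < 2 * n → y < 2 * n →
                  (Covers (φ-edge n h) x ⇔ Covers (φ-edge n h) y) ⇔ (Covers h (suc x) ⇔ Covers h (suc y))
  φ-edge-covers {h} {x} {y} h∈ x<2n y<2n with start h∈
  ... | first-side j = ⇔-cong-¬ (covers? _ (suc x)) (covers? _ (suc y)) (complement x<2n) (complement y<2n)
    where
    complement : ∀ {z} → z < 2 * n → Covers (suc j , 2 * n) z ⇔ (¬ Covers (1 , suc (suc j)) (suc z))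
    complement z<2n = mk⇔ (λ (j<z , _) (_ , z≤j) → <-irrefl refl (<-≤-trans (≤-pred z≤j) j<z))
                          (λ uncovered → ≮⇒≥ (λ z≤j → uncovered (s≤s z≤n , s≤s z≤j)) , z<2n)
  ... | later-side i j = ⇔-cong shifted shifted
    where
    shifted : ∀ {z} → Covers (suc i , j) z ⇔ Covers (suc (suc i) , suc j) (suc z)
    shifted = mk⇔ (λ (i<z , z<j) → s≤s i<z , s≤s z<j) (λ (i<z , z<j) → ≤-pred i<z , ≤-pred z<j)

  SameVertex-φ : ∀ {x y} → x < 2 * n → y < 2 * n → SameVertex (φ n T) x y ⇔ SameVertex T (suc x) (suc y)
  SameVertex-φ x<2n y<2n = mk⇔
    (λ x~y h h∈ → to (φ-edge-covers h∈ x<2n y<2n) (x~y _ (φ-edge∈ h∈)))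
    (λ x~y h′ h′∈ → case ∈-map⁻ (φ-edge n) h′∈ of λ where
      (h , h∈ , refl) → from (φ-edge-covers h∈ x<2n y<2n) (x~y h h∈))

module Kreweras {n : ℕ} {T : PairSet} (pt : IsPlaneTree n T) where
  open PlaneTree pt
  private module Φ = PlaneTree φ-isPlaneTree

  odd-gap<2n : (k : Fin n) → suc (2 * toℕ k) < 2 * n
  odd-gap<2n k = subst (_≤ 2 * n) (*-suc 2 (toℕ k)) (*-monoʳ-≤ 2 (toℕ<n k))

  ρφ⇔SameVertex : ∀ k l → ρ n (φ n T) k l ⇔ SameVertex T (suc (2 * toℕ k)) (suc (2 * toℕ l))
  ρφ⇔SameVertex k l = ⇔.trans (Φ.ρ⇔SameVertex k l) (SameVertex-φ (2k<2n k) (2k<2n l))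

  ¬SameVertex-even-odd : ∀ k l → ¬ SameVertex T (2 * toℕ k) (suc (2 * toℕ l))
  ¬SameVertex-even-odd k l k~l with trans (sym (odd-2* (toℕ k)))
    (trans (SameVertex-parity (2k<2n k) (odd-gap<2n l) k~l) (odd-1+2* (toℕ l)))
  ... | ()

  -- In the interleaved order k sits at the even gap 2k and k′ at the odd gap 2k + 1.
  Union⇔SameVertex : ∀ a b → Union (ρ n T) (ρ n (φ n T)) a b ⇔ SameVertex T (posInter a) (posInter b)
  Union⇔SameVertex (inj₁ k) (inj₁ l) = ρ⇔SameVertex k l
  Union⇔SameVertex (inj₂ k) (inj₂ l) = ρφ⇔SameVertex k l
  Union⇔SameVertex (inj₁ k) (inj₂ l) = mk⇔ (λ ()) (¬SameVertex-even-odd k l)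
  Union⇔SameVertex (inj₂ k) (inj₁ l) = mk⇔ (λ ()) (¬SameVertex-even-odd l k ∘ ~.sym)

  Separates : Fin n → Fin n → Fin n → Fin n → Set
  Separates k l x y = posInter (inj₁ k) < posInter (inj₂ x) × posInter (inj₂ x) < posInter (inj₁ l) ×
                      (posInter (inj₂ y) < posInter (inj₁ k) ⊎ posInter (inj₁ l) < posInter (inj₂ y))

  separated-blocks-cross : ∀ {Q′ : Partition (Fin n)} {k l x y} → NonCrossing posInter (Union (ρ n T) Q′) →
                           ρ n T k l → Q′ x y → Q′ y x → Separates k l x y → ⊥
  separated-blocks-cross {k = k} {l} {x} {y} nc kl xy yx (k<x , x<l , inj₁ y<k) =
    nc (inj₂ y) (inj₁ k) (inj₂ x) (inj₁ l) y<k k<x x<l yx kl λ ()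
  separated-blocks-cross {k = k} {l} {x} {y} nc kl xy yx (k<x , x<l , inj₂ l<y) =
    nc (inj₁ k) (inj₂ x) (inj₁ l) (inj₂ y) k<x x<l l<y kl xy λ ()

  SeparatingBlock : Fin n → Fin n → Set
  SeparatingBlock x y = ∃₂ λ k l → ρ n T k l × (Separates k l x y ⊎ Separates k l y x)

  even-start-separates : ∀ {k l} x y → (2 * toℕ k , suc (2 * toℕ l)) ∈ T →
                         Covers (2 * toℕ k , suc (2 * toℕ l)) (suc (2 * toℕ x)) →
                         ¬ Covers (2 * toℕ k , suc (2 * toℕ l)) (suc (2 * toℕ y)) → SeparatingBlock x y
  even-start-separates {k} {l} x y h∈ (k≤x , x<1+l) uncovered =
    k , l , from (ρ⇔SameVertex k l) (SameVertex-first-last h∈) ,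
    inj₁ ( even≤odd⇒< (toℕ k) (toℕ x) k≤x
         , odd≤even⇒< (toℕ x) (toℕ l) (≤-pred x<1+l)
         , uncovered⇒outside uncovered )

  odd-start-separates : ∀ {k l} x y → (suc (2 * toℕ k) , 2 * toℕ l) ∈ T →
                        Covers (suc (2 * toℕ k) , 2 * toℕ l) (suc (2 * toℕ x)) →
                        ¬ Covers (suc (2 * toℕ k) , 2 * toℕ l) (suc (2 * toℕ y)) → SeparatingBlock x y
  odd-start-separates {k} {l} x y h∈ (k<x , x<l) uncovered =
    k , l , from (ρ⇔SameVertex k l) (SameVertex-before-after h∈) ,
    inj₁ (k<x , x<l , map (λ y<1+k → odd≤even⇒< (toℕ y) (toℕ k) (≤-pred y<1+k)) (even≤odd⇒< (toℕ l) (toℕ y))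
                          (uncovered⇒outside uncovered))

  last-edge-separates : ∀ {k} x y → (suc (2 * toℕ k) , 2 * n) ∈ T →
                        Covers (suc (2 * toℕ k) , 2 * n) (suc (2 * toℕ x)) →
                        ¬ Covers (suc (2 * toℕ k) , 2 * n) (suc (2 * toℕ y)) → SeparatingBlock x y
  last-edge-separates {k} x y h∈ (k<x , _) uncovered with toFin {n} {0} (≤-trans (s≤s z≤n) (toℕ<n k))
  ... | o , o≡0 =
    o , k ,
    from (ρ⇔SameVertex o k) (subst (λ m → SameVertex T (2 * m) _) (sym o≡0) (SameVertex-root-before-last h∈)) ,
    inj₂ (subst (λ m → 2 * m < _) (sym o≡0) (s≤s z≤n) , y<k , inj₂ k<x)
    where
    y<k : suc (2 * toℕ y) < 2 * toℕ k
    y<k with uncovered⇒outside uncovered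
    ... | inj₁ y<1+k = odd≤even⇒< (toℕ y) (toℕ k) (≤-pred y<1+k)
    ... | inj₂ 2n≤y  = ⊥-elim (<-irrefl refl (<-≤-trans (odd-gap<2n y) 2n≤y))

  -- The separating block consists of the even gaps next to the two ends of h (or of gap 0 and the
  -- gap before h, when h ends at the last side).
  separating-block : ∀ {h} x y → h ∈ T → Covers h (suc (2 * toℕ x)) → ¬ Covers h (suc (2 * toℕ y)) →
                     SeparatingBlock x y
  separating-block {i , j} x y h∈ covered uncovered with odd i in i-parity
  ... | false with even⇒≡2* i i-parity | odd⇒≡1+2* j (trans (odd-right h∈) (cong not i-parity))
  ...   | s , refl | t , refl
    with toFin (*-cancelˡ-< 2 s n (<-≤-trans (left<right h∈) (right≤2n h∈)))
       | toFin (*-cancelˡ-< 2 t n (<-≤-trans (n<1+n _) (right≤2n h∈)))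
  ...     | k , refl | l , refl = even-start-separates {k} {l} x y h∈ covered uncovered
  separating-block {i , j} x y h∈ covered uncovered | true with odd⇒≡1+2* i i-parity
  ... | s , refl with toFin {n} (*-cancelˡ-< 2 s n (<-≤-trans (<-trans (n<1+n _) (left<right h∈)) (right≤2n h∈)))
  ...   | k , refl with m≤n⇒m<n∨m≡n (right≤2n h∈)
  ...     | inj₂ refl = last-edge-separates {k} x y h∈ covered uncovered
  ...     | inj₁ j<2n with even⇒≡2* j (trans (odd-right h∈) (cong not i-parity))
  ...       | t , refl with toFin {n} (*-cancelˡ-< 2 t n j<2n)
  ...         | l , refl = odd-start-separates {k} {l} x y h∈ covered uncovered

  ρφ-coarsest : (Q′ : Partition (Fin n)) → IsNCPartition n Q′ →
                NonCrossing posInter (Union (ρ n T) Q′) → Refines Q′ (ρ n (φ n T))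
  ρφ-coarsest Q′ (Q′-isEquivalence , _) nc x y xy = from (ρφ⇔SameVertex x y) λ h h∈ →
    mk⇔ (still-covered x y xy (sym′ xy) h∈) (still-covered y x (sym′ xy) xy h∈)
    where
    sym′ = IsEquivalence.sym Q′-isEquivalence
    still-covered : ∀ x y → Q′ x y → Q′ y x → ∀ {h} → h ∈ T →
                    Covers h (suc (2 * toℕ x)) → Covers h (suc (2 * toℕ y))
    still-covered x y xy yx {h} h∈ covered = decidable-stable (covers? h _) λ uncovered →
      case separating-block x y h∈ covered uncovered of λ where
        (_ , _ , kl , inj₁ separated) → separated-blocks-cross nc kl xy yx separated
        (_ , _ , kl , inj₂ separated) → separated-blocks-cross nc kl yx xy separated

theorem1 : (n : ℕ) → 1 ≤ n → (T : PairSet) → IsPlaneTree n T →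
             IsKreweras n (ρ n T) (ρ n (φ n T))
theorem1 n _ T pt =
  ( ( pullback-isEquivalence odd-gap ρφ⇔SameVertex
    , pullback-noncrossing odd-gap ρφ⇔SameVertex posN (λ k<l → s≤s (*-monoʳ-< 2 k<l)) )
  , pullback-noncrossing posInter Union⇔SameVertex posInter id
  , ρφ-coarsest )
  where
  open Kreweras pt
  odd-gap : Fin n → ℕ
  odd-gap k = suc (2 * toℕ k)
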